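{- Closed branches are not realizable: if a CSS $\langle\mathcal F,\mathcal C\rangle$ is closed, then it has no realization.
   Context: SEMANTICS. Fix a finite set $A$ of agents, a finite set $Res$ of resources containing $e$ with a partial operation $\cdot$, and a countable set $\mathrm{Prop}$ of atoms. Formulas: $\phi ::= p \mid \bot \mid \top \mid \neg\phi \mid I \mid \phi\vee\phi \mid \phi\wedge\phi \mid \phi\to\phi \mid \phi*\phi \mid \phi\mathbin{ -\!*}\phi \mid C_u^r\phi \mid D_u^r\phi \mid E_u^r\phi \mid \widehat C_u^r\phi\mid\widehat D_u^r\phi\mid\widehat E_u^r\phi$ ($u\in A$, $r\in Res$), $\widehat X_u^r\phi$ abbreviating $\neg X_u^r\neg\phi$. A partial resource monoid is $(R,\bullet)$ with $Res\subseteq R$, $\bullet$ partial, such that for all $r_1,r_2,r_3\in R$: if all lie in $Res$ then $r_1=r_2\cdot r_3$ iff $r_1=r_2\bullet r_3$; $r_1\bullet e$ is defined and equals $r_1$; partial commutativity and associativity. A model is $\mathcal M=((R,\bullet),\{\sim_u\}_{u\in A},V)$, each $\sim_u$ an equivalence on $R$, $V:\mathrm{Prop}\to\wp(R)$. Satisfaction: atoms via $V$; $\bot$ never; $\top$ always; classical $\neg,\vee,\wedge,\to$; $r\models I$ iff $r=e$; $r\models\phi*\psi$ iff $r=r_1\bullet r_2$ (defined) with $r_1\models\phi,r_2\models\psi$; $r\models\phi\mathbin{ -\!*}\psi$ iff for all $r'$ with $r\bullet r'$ defined and $r'\models\phi$, $r\bullet r'\models\psi$; $r\models C_u^s\phi$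 iff, if $r\bullet s$ is defined, all $r'$ with $r\bullet s\sim_u r'$ satisfy $\phi$; $r\models D_u^s\phi$ iff some $r'$ has $r'\bullet s$ defined, $r\sim_u r'\bullet s$, $r'\bullet s\models\phi$; $r\models E_u^s\phi$ iff, if $r\bullet s$ is defined, every $r'$ with $r'\bullet s$ defined and $r\bullet s\sim_u r'\bullet s$ has $r'\bullet s\models\phi$. LABELS AND CONSTRAINTS. $\Lambda_r$ is a finite set of constants with $|\Lambda_r|=|Res|-1$, $\gamma_r=\Lambda_r\cup\{c_1,c_2,\dots\}$. A label is a finite multiset over $\gamma_r$; $xy$ is union, $\epsilon$ empty; $y$ is a sublabel of $x$ if $x=yz$. $\lambda:Res\to\Lambda_r\cup\{\epsilon\}$ is a fixed bijection with $\lambda(e)=\epsilon$. Constraints: $x\approx y$ and $x\asymp_u y$ ($u\in A$). $\mathcal D(\mathcal C)$: set of all sublabels of labels occurring in $\mathcal C$. Closure $\overline{\mathcal C}$: least superset closed under $\epsilon\approx\epsilon$; $x\approx y\Rightarrow y\approx x$; $xy\approx xy\Rightarrow x\approx x$; $x\approx y,\ y\approx z\Rightarrow x\approx z$; $x\approx y,\ yk\approx yk\Rightarrow xk\approx yk$; $x\asymp_u y\Rightarrow x\approx x$; $x\approx x\Rightarrow x\asymp_v x$ ($v\in A$); $x\asymp_u y\Rightarrow y\asymp_u x$; $x\asymp_u y,\ y\asymp_u z\Rightarrow x\asymp_u z$; $x\asymp_u y,\ x\approx k\Rightarrow k\asymp_u y$. CSS. A labelled formula is $(S,\phi,x)$ with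 $S\in\{\mathbb T,\mathbb F\}$. A CSS is a pair $\langle\mathcal F,\mathcal C\rangle$ with $(S,\phi,x)\in\mathcal F\Rightarrow x\approx x\in\overline{\mathcal C}$. It is closed if (1) $(\mathbb T,\phi,x),(\mathbb F,\phi,y)\in\mathcal F$ and $x\approx y\in\overline{\mathcal C}$; or (2) $(\mathbb F,I,x)\in\mathcal F$ and $x\approx\epsilon\in\overline{\mathcal C}$; or (3) $(\mathbb F,\top,x)\in\mathcal F$; or (4) $(\mathbb T,\bot,x)\in\mathcal F$. REALIZATION. A realization of $\langle\mathcal F,\mathcal C\rangle$ is a pair $(\mathcal M,\lfloor\cdot\rfloor)$ with $\mathcal M$ a model and $\lfloor\cdot\rfloor:\mathcal D(\mathcal C)\to R$ total such that: $\lfloor\lambda(r)\rfloor=r$ for all $r\in Res$ and $\lfloor\epsilon\rfloor=e$; if $xy\in\mathcal D(\mathcal C)$ then $\lfloor x\rfloor\bullet\lfloor y\rfloor$ is defined and equals $\lfloor xy\rfloor$; $(\mathbb T,\phi,x)\in\mathcal F\Rightarrow\lfloor x\rfloor\models\phi$; $(\mathbb F,\phi,x)\in\mathcal F\Rightarrow\lfloor x\rfloor\not\models\phi$; $x\approx y\in\mathcal C\Rightarrow\lfloor x\rfloor=\lfloor y\rfloor$; $x\asymp_u y\in\mathcal C\Rightarrow\lfloor x\rfloor\sim_u\lfloor y\rfloor$. -}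

module Defs where

open import Data.Nat using (ℕ) renaming (suc to sucℕ)
open import Data.Fin using (Fin; zero; suc)
open import Data.Sum using (_⊎_; inj₁; inj₂)
open import Data.Product using (_×_; _,_; ∃)
open import Data.Maybe.Base using (Maybe; just; nothing; _>>=_)
open import Data.List using (List; []; _∷_; _++_)
open import Data.List.Relation.Binary.Permutation.Propositional using (_↭_)
open import Data.Empty using (⊥)
open import Data.Unit using (⊤)
open import Relation.Nullary using (¬_)
open import Relation.Binary.PropositionalEquality using (_≡_)
open import Relation.Binary.Structures using (IsEquivalence)
open import Function.Bundles using (_⇔_)

-- The fixed parameters: a finite set A = Fin nAgents of agents, a finite set
-- Res = Fin (suc k) of resources (so |Res| - 1 = k) whose unit e is 'zero',
-- and the partial operation · on Res.
record Signature : Set where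
  field
    nAgents : ℕ
    k       : ℕ
    _·_     : Fin (sucℕ k) → Fin (sucℕ k) → Maybe (Fin (sucℕ k))

module Theory (σ : Signature) where
  open Signature σ public

  Agent : Set
  Agent = Fin nAgents

  Res : Set
  Res = Fin (sucℕ k)

  e : Res
  e = zero

  Atom : Set
  Atom = ℕ

  infixr 6 _∧f_ _∨f_ _✱_
  infixr 5 _⇒f_ _-✱_
  data Formula : Set where
    atom  : Atom → Formula
    ⊥f ⊤f : Formula
    ¬f_   : Formula → Formula
    If    : Formula
    _∨f_ _∧f_ _⇒f_ _✱_ _-✱_ : Formula → Formula → Formula
    C⟨_,_⟩_ D⟨_,_⟩_ E⟨_,_⟩_ : Agent → Res → Formula → Formula

  Ĉ⟨_,_⟩_ D̂⟨_,_⟩_ Ê⟨_,_⟩_ : Agent → Res → Formula → Formula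
  Ĉ⟨ u , r ⟩ φ = ¬f (C⟨ u , r ⟩ (¬f φ))
  D̂⟨ u , r ⟩ φ = ¬f (D⟨ u , r ⟩ (¬f φ))
  Ê⟨ u , r ⟩ φ = ¬f (E⟨ u , r ⟩ (¬f φ))

  -- Partial resource monoids (partial operation as R → R → Maybe R,
  -- Res ⊆ R via an injection ι)
  record PRM : Set₁ where
    field
      R     : Set
      _•_   : R → R → Maybe R
      ι     : Res → R
      ι-inj : ∀ {r s} → ι r ≡ ι s → r ≡ s
      compat : ∀ r₁ r₂ r₃ → (r₂ · r₃ ≡ just r₁) ⇔ (ι r₂ • ι r₃ ≡ just (ι r₁))
      unit  : ∀ r → r • ι e ≡ just r
      comm  : ∀ r₁ r₂ → r₁ • r₂ ≡ r₂ • r₁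
      assoc : ∀ r₁ r₂ r₃ →
              ((r₁ • r₂) >>= λ t → t • r₃) ≡ ((r₂ • r₃) >>= λ t → r₁ • t)

  record Model : Set₁ where
    field
      prm : PRM
    open PRM prm public
    field
      _∼⟨_⟩_ : R → Agent → R → Set
      ∼-equiv : ∀ u → IsEquivalence (λ x y → x ∼⟨ u ⟩ y)
      V : Atom → R → Set

  module Sem (M : Model) where
    open Model M
    _⊨_ : R → Formula → Set
    r ⊨ atom p = V p r
    r ⊨ ⊥f = ⊥
    r ⊨ ⊤f = ⊤
    r ⊨ (¬f φ) = ¬ (r ⊨ φ)
    r ⊨ If = r ≡ ι e
    r ⊨ (φ ∨f ψ) = (r ⊨ φ) ⊎ (r ⊨ ψ)
    r ⊨ (φ ∧f ψ) = (r ⊨ φ) × (r ⊨ ψ)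
    r ⊨ (φ ⇒f ψ) = r ⊨ φ → r ⊨ ψ
    r ⊨ (φ ✱ ψ) = ∃ λ r₁ → ∃ λ r₂ → (r₁ • r₂ ≡ just r) × (r₁ ⊨ φ) × (r₂ ⊨ ψ)
    r ⊨ (φ -✱ ψ) = ∀ r' r'' → r • r' ≡ just r'' → r' ⊨ φ → r'' ⊨ ψ
    r ⊨ (C⟨ u , s ⟩ φ) = ∀ t → r • ι s ≡ just t → ∀ r' → t ∼⟨ u ⟩ r' → r' ⊨ φ
    r ⊨ (D⟨ u , s ⟩ φ) =
      ∃ λ r' → ∃ λ t → (r' • ι s ≡ just t) × (r ∼⟨ u ⟩ t) × (t ⊨ φ)
    r ⊨ (E⟨ u , s ⟩ φ) = ∀ t → r • ι s ≡ just t →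
      ∀ r' t' → r' • ι s ≡ just t' → t ∼⟨ u ⟩ t' → t' ⊨ φ

  Sat : (M : Model) → Model.R M → Formula → Set
  Sat M = Sem._⊨_ M

  -- Labels: finite multisets over γ_r = Λ_r ∪ {c₁, c₂, …}, represented
  -- as lists taken up to permutation (_↭_).  Λ_r = Fin k, c_{i+1} = inj₂ i.
  Letter : Set
  Letter = Fin k ⊎ ℕ

  Label : Set
  Label = List Letter

  ε : Label
  ε = []

  lam : Res → Label
  lam zero    = ε
  lam (suc i) = inj₁ i ∷ []

  infix 4 _≈_ _≍⟨_⟩_
  data Constraint : Set where
    _≈_     : Label → Label → Constraint
    _≍⟨_⟩_  : Label → Agent → Label → Constraint

  _≋c_ : Constraint → Constraint → Set
  (x ≈ y) ≋c (x' ≈ y') = (x ↭ x') × (y ↭ y')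
  (x ≍⟨ u ⟩ y) ≋c (x' ≍⟨ u' ⟩ y') = (x ↭ x') × (u ≡ u') × (y ↭ y')
  _ ≋c _ = ⊥

  -- the closure  \overline{𝒞}  (xy is multiset union, i.e. x ++ y up to ↭)
  data Closure (𝒞 : Constraint → Set) : Constraint → Set where
    base   : ∀ {c} → 𝒞 c → Closure 𝒞 c
    mset   : ∀ {c c'} → Closure 𝒞 c → c ≋c c' → Closure 𝒞 c'
    ε-refl : Closure 𝒞 (ε ≈ ε)
    ≈-sym  : ∀ {x y} → Closure 𝒞 (x ≈ y) → Closure 𝒞 (y ≈ x)
    ≈-sub  : ∀ {x y} → Closure 𝒞 (x ++ y ≈ x ++ y) → Closure 𝒞 (x ≈ x)
    ≈-trans : ∀ {x y z} → Closure 𝒞 (x ≈ y) → Closure 𝒞 (y ≈ z) →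
              Closure 𝒞 (x ≈ z)
    ≈-cong : ∀ {x y k} → Closure 𝒞 (x ≈ y) → Closure 𝒞 (y ++ k ≈ y ++ k) →
             Closure 𝒞 (x ++ k ≈ y ++ k)
    ≍⇒≈    : ∀ {x u y} → Closure 𝒞 (x ≍⟨ u ⟩ y) → Closure 𝒞 (x ≈ x)
    ≍-refl : ∀ {x} v → Closure 𝒞 (x ≈ x) → Closure 𝒞 (x ≍⟨ v ⟩ x)
    ≍-sym  : ∀ {x u y} → Closure 𝒞 (x ≍⟨ u ⟩ y) → Closure 𝒞 (y ≍⟨ u ⟩ x)
    ≍-trans : ∀ {x u y z} → Closure 𝒞 (x ≍⟨ u ⟩ y) → Closure 𝒞 (y ≍⟨ u ⟩ z) →
              Closure 𝒞 (x ≍⟨ u ⟩ z)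
    ≍-subst : ∀ {x u y k} → Closure 𝒞 (x ≍⟨ u ⟩ y) → Closure 𝒞 (x ≈ k) →
              Closure 𝒞 (k ≍⟨ u ⟩ y)

  Occurs : Constraint → Label → Set
  Occurs (x ≈ y) l = (l ≡ x) ⊎ (l ≡ y)
  Occurs (x ≍⟨ u ⟩ y) l = (l ≡ x) ⊎ (l ≡ y)

  InD : (Constraint → Set) → Label → Set
  InD 𝒞 x = ∃ λ c → 𝒞 c × ∃ λ l → Occurs c l × ∃ λ z → l ↭ (x ++ z)

  data Sign : Set where
    𝕋 𝔽 : Sign

  record LFormula : Set where
    constructor ⟨_,_,_⟩
    field
      sign    : Sign
      formula : Formula
      label   : Label

  IsCSS : (LFormula → Set) → (Constraint → Set) → Set
  IsCSS ℱ 𝒞 = ∀ {S φ x} → ℱ ⟨ S , φ , x ⟩ → Closure 𝒞 (x ≈ x)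

  data Closed (ℱ : LFormula → Set) (𝒞 : Constraint → Set) : Set where
    clash : ∀ φ x y → ℱ ⟨ 𝕋 , φ , x ⟩ → ℱ ⟨ 𝔽 , φ , y ⟩ →
            Closure 𝒞 (x ≈ y) → Closed ℱ 𝒞
    F-I   : ∀ x → ℱ ⟨ 𝔽 , If , x ⟩ → Closure 𝒞 (x ≈ ε) → Closed ℱ 𝒞
    F-⊤   : ∀ x → ℱ ⟨ 𝔽 , ⊤f , x ⟩ → Closed ℱ 𝒞
    T-⊥   : ∀ x → ℱ ⟨ 𝕋 , ⊥f , x ⟩ → Closed ℱ 𝒞

  -- Realizations.  ⌊_⌋ is given as a total map on labels (only its values on
  -- 𝒟(𝒞) matter), respecting multiset equality; labels of formulas in ℱ
  -- must lie in 𝒟(𝒞), the domain of ⌊_⌋ in the paper.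
  record Realization (ℱ : LFormula → Set) (𝒞 : Constraint → Set) : Set₁ where
    field
      M : Model
    open Model M
    field
      ⌊_⌋    : Label → R
      ⌊⌋-↭   : ∀ {x y} → x ↭ y → ⌊ x ⌋ ≡ ⌊ y ⌋
      ⌊lam⌋  : ∀ r → ⌊ lam r ⌋ ≡ ι r
      ⌊ε⌋    : ⌊ ε ⌋ ≡ ι e
      ⌊++⌋   : ∀ x y → InD 𝒞 (x ++ y) → ⌊ x ⌋ • ⌊ y ⌋ ≡ just ⌊ x ++ y ⌋
      ⌊𝕋⌋    : ∀ φ x → ℱ ⟨ 𝕋 , φ , x ⟩ → InD 𝒞 x × Sat M ⌊ x ⌋ φ
      ⌊𝔽⌋    : ∀ φ x → ℱ ⟨ 𝔽 , φ , x ⟩ → InD 𝒞 x × ¬ Sat M ⌊ x ⌋ φ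
      ⌊≈⌋    : ∀ x y → 𝒞 (x ≈ y) → ⌊ x ⌋ ≡ ⌊ y ⌋
      ⌊≍⌋    : ∀ x u y → 𝒞 (x ≍⟨ u ⟩ y) → ⌊ x ⌋ ∼⟨ u ⟩ ⌊ y ⌋

module Submission where

open import Defs
open import Relation.Nullary using (¬_)
open import Data.Sum using (inj₁; inj₂)
open import Data.Product using (_,_; proj₂)
open import Data.Maybe.Base using (Maybe; just; nothing; _>>=_)
open import Data.List using (List; []; _∷_; _++_)
open import Data.List.Properties using (++-assoc; ++-identityʳ)
open import Data.List.Relation.Binary.Permutation.Propositional
  using (_↭_; refl; prep; swap; trans; ↭-reflexive; ↭-trans)
open import Data.List.Relation.Binary.Permutation.Propositional.Properties using (shifts)
open import Data.Empty using (⊥)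
open import Data.Unit using (tt)
open import Relation.Binary.Definitions using (Reflexive; Symmetric; Transitive)
open import Relation.Binary.Structures using (IsEquivalence)
open import Relation.Binary.PropositionalEquality
  using (_≡_; cong; sym; subst; subst₂; module ≡-Reasoning)
  renaming (refl to ≡-refl; trans to ≡-trans)

-- A realization ⌊_⌋ is only required to be additive on 𝒟(𝒞), whereas the
-- closure rules (e.g. ≈-cong) produce constraints on labels outside 𝒟(𝒞).
-- We therefore interpret every label x, not only those in 𝒟(𝒞), by its
-- *evaluation* ⟦ x ⟧ : Maybe R, the (possibly undefined) product of the
-- resources ⌊ a ∷ [] ⌋ of its letters.  The evaluation is computed with the
-- partial product lifted to Maybe R, which is a commutative monoid; hence
-- ⟦_⟧ is a monoid morphism from labels that is invariant under permutation
-- (so it is well-defined on multisets), and it agrees with ⌊_⌋ on 𝒟(𝒞).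
-- Reading x ≈ y as "⟦ x ⟧ and ⟦ y ⟧ are defined and equal" and x ≍⟨ u ⟩ y
-- as "both are defined and ∼⟨ u ⟩-related", every rule of the closure is
-- sound, so each constraint in the closure of 𝒞 holds.  Each of the four
-- closure conditions then contradicts the requirements on ⌊_⌋ for ℱ.

data Both {A : Set} (_~_ : A → A → Set) : Maybe A → Maybe A → Set where
  both : ∀ {a b} → a ~ b → Both _~_ (just a) (just b)

Defined : {A : Set} → Maybe A → Set
Defined m = Both _≡_ m m

module _ {A : Set} {_~_ : A → A → Set} where

  Both-sym : Symmetric _~_ → ∀ {m n} → Both _~_ m n → Both _~_ n m
  Both-sym ~-sym (both r) = both (~-sym r)

  Both-trans : Transitive _~_ → ∀ {m n o} → Both _~_ m n → Both _~_ n o → Both _~_ m o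
  Both-trans ~-trans (both r) (both s) = both (~-trans r s)

  Both-reflˡ : ∀ {m n} → Both _~_ m n → Defined m
  Both-reflˡ (both _) = both ≡-refl

  Both-refl : Reflexive _~_ → ∀ {m} → Defined m → Both _~_ m m
  Both-refl ~-refl (both _) = both ~-refl

  Both-just : ∀ {m n a b} → m ≡ just a → n ≡ just b → a ~ b → Both _~_ m n
  Both-just ≡-refl ≡-refl r = both r

  Both-just⁻¹ : ∀ {m n a b} → Both _~_ m n → m ≡ just a → n ≡ just b → a ~ b
  Both-just⁻¹ (both r) ≡-refl ≡-refl = r

Both-≡ : ∀ {A : Set} {m n : Maybe A} → Both _≡_ m n → m ≡ n
Both-≡ (both ≡-refl) = ≡-refl

module LiftedProduct (σ : Signature) (P : Theory.PRM σ) where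
  open Theory σ using (PRM; e)
  open PRM P

  infixr 6 _⊛_
  _⊛_ : Maybe R → Maybe R → Maybe R
  m ⊛ n = m >>= λ a → n >>= λ b → a • b

  ⊛-comm : ∀ m n → m ⊛ n ≡ n ⊛ m
  ⊛-comm nothing  nothing  = ≡-refl
  ⊛-comm nothing  (just b) = ≡-refl
  ⊛-comm (just a) nothing  = ≡-refl
  ⊛-comm (just a) (just b) = comm a b

  ⊛-assoc : ∀ m n o → (m ⊛ n) ⊛ o ≡ m ⊛ (n ⊛ o)
  ⊛-assoc nothing  n        o        = ≡-refl
  ⊛-assoc (just a) nothing  o        = ≡-refl
  ⊛-assoc (just a) (just b) (just c) = assoc a b c
  ⊛-assoc (just a) (just b) nothing  with a • b
  ... | nothing = ≡-refl
  ... | just _  = ≡-refl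

  ⊛-identityˡ : ∀ m → just (ι e) ⊛ m ≡ m
  ⊛-identityˡ nothing  = ≡-refl
  ⊛-identityˡ (just b) = ≡-trans (comm (ι e) b) (unit b)

  ⊛-left-comm : ∀ m n o → m ⊛ (n ⊛ o) ≡ n ⊛ (m ⊛ o)
  ⊛-left-comm m n o = begin
    m ⊛ (n ⊛ o)  ≡⟨ sym (⊛-assoc m n o) ⟩
    (m ⊛ n) ⊛ o  ≡⟨ cong (_⊛ o) (⊛-comm m n) ⟩
    (n ⊛ m) ⊛ o  ≡⟨ ⊛-assoc n m o ⟩
    n ⊛ (m ⊛ o)  ∎
    where open ≡-Reasoning

  ⊛-definedˡ : ∀ m n → Defined (m ⊛ n) → Defined m
  ⊛-definedˡ nothing  n ()
  ⊛-definedˡ (just a) n _ = both ≡-refl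

  module Evaluation {L : Set} (g : L → R) where

    ⟦_⟧ : List L → Maybe R
    ⟦ []    ⟧ = just (ι e)
    ⟦ a ∷ l ⟧ = just (g a) ⊛ ⟦ l ⟧

    ⟦⟧-++ : ∀ x y → ⟦ x ++ y ⟧ ≡ ⟦ x ⟧ ⊛ ⟦ y ⟧
    ⟦⟧-++ []      y = sym (⊛-identityˡ ⟦ y ⟧)
    ⟦⟧-++ (a ∷ x) y = begin
      just (g a) ⊛ ⟦ x ++ y ⟧          ≡⟨ cong (just (g a) ⊛_) (⟦⟧-++ x y) ⟩
      just (g a) ⊛ (⟦ x ⟧ ⊛ ⟦ y ⟧)     ≡⟨ sym (⊛-assoc (just (g a)) ⟦ x ⟧ ⟦ y ⟧) ⟩
      (just (g a) ⊛ ⟦ x ⟧) ⊛ ⟦ y ⟧     ∎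
      where open ≡-Reasoning

    ⟦⟧-↭ : ∀ {x y} → x ↭ y → ⟦ x ⟧ ≡ ⟦ y ⟧
    ⟦⟧-↭ refl              = ≡-refl
    ⟦⟧-↭ (prep a p)        = cong (just (g a) ⊛_) (⟦⟧-↭ p)
    ⟦⟧-↭ (swap {xs} a b p) = ≡-trans (⊛-left-comm (just (g a)) (just (g b)) ⟦ xs ⟧)
                               (cong (λ m → just (g b) ⊛ just (g a) ⊛ m) (⟦⟧-↭ p))
    ⟦⟧-↭ (trans p q)       = ≡-trans (⟦⟧-↭ p) (⟦⟧-↭ q)

module Soundness (σ : Signature) (ℱ : Theory.LFormula σ → Set)
                 (𝒞 : Theory.Constraint σ → Set) (ρ : Theory.Realization σ ℱ 𝒞) where
  open Theory σ
  open Realization ρ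
  open Model M
  open LiftedProduct σ prm
  open Evaluation (λ a → ⌊ a ∷ [] ⌋)

  InD-sublabel : ∀ x y → InD 𝒞 (x ++ y) → InD 𝒞 y
  InD-sublabel x y (c , c∈𝒞 , l , l-occurs , z , l↭xyz) =
    c , c∈𝒞 , l , l-occurs , x ++ z ,
    ↭-trans l↭xyz (↭-trans (↭-reflexive (++-assoc x y z)) (shifts x y))

  InD-occurs : ∀ {c} x → 𝒞 c → Occurs c x → InD 𝒞 x
  InD-occurs {c} x c∈𝒞 x-occurs =
    c , c∈𝒞 , x , x-occurs , [] , ↭-reflexive (sym (++-identityʳ x))

  ⟦⟧-realized : ∀ x → InD 𝒞 x → ⟦ x ⟧ ≡ just ⌊ x ⌋
  ⟦⟧-realized []      _  = cong just (sym ⌊ε⌋)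
  ⟦⟧-realized (a ∷ x) ax∈𝒟 = begin
    just ⌊ a ∷ [] ⌋ ⊛ ⟦ x ⟧       ≡⟨ cong (just ⌊ a ∷ [] ⌋ ⊛_) (⟦⟧-realized x (InD-sublabel (a ∷ []) x ax∈𝒟)) ⟩
    ⌊ a ∷ [] ⌋ • ⌊ x ⌋            ≡⟨ ⌊++⌋ (a ∷ []) x ax∈𝒟 ⟩
    just ⌊ a ∷ x ⌋                ∎
    where open ≡-Reasoning

  Holds : Constraint → Set
  Holds (x ≈ y)      = Both _≡_ ⟦ x ⟧ ⟦ y ⟧
  Holds (x ≍⟨ u ⟩ y) = Both (λ a b → a ∼⟨ u ⟩ b) ⟦ x ⟧ ⟦ y ⟧

  Holds-≋ : ∀ c c' → c ≋c c' → Holds c → Holds c'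
  Holds-≋ (x ≈ y)      (x' ≈ y')       (x↭x' , y↭y')          = subst₂ (Both _≡_) (⟦⟧-↭ x↭x') (⟦⟧-↭ y↭y')
  Holds-≋ (x ≍⟨ u ⟩ y) (x' ≍⟨ .u ⟩ y') (x↭x' , ≡-refl , y↭y') = subst₂ (Both _) (⟦⟧-↭ x↭x') (⟦⟧-↭ y↭y')

  closure-sound : ∀ {c} → Closure 𝒞 c → Holds c
  closure-sound (base {x ≈ y} c∈𝒞) =
    Both-just (⟦⟧-realized x (InD-occurs x c∈𝒞 (inj₁ ≡-refl)))
              (⟦⟧-realized y (InD-occurs y c∈𝒞 (inj₂ ≡-refl))) (⌊≈⌋ x y c∈𝒞)
  closure-sound (base {x ≍⟨ u ⟩ y} c∈𝒞) =
    Both-just (⟦⟧-realized x (InD-occurs x c∈𝒞 (inj₁ ≡-refl)))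
              (⟦⟧-realized y (InD-occurs y c∈𝒞 (inj₂ ≡-refl))) (⌊≍⌋ x u y c∈𝒞)
  closure-sound (mset {c} {c'} h c≋c') = Holds-≋ c c' c≋c' (closure-sound h)
  closure-sound ε-refl = both ≡-refl
  closure-sound (≈-sym h) = Both-sym sym (closure-sound h)
  closure-sound (≈-sub {x} {y} h) =
    ⊛-definedˡ ⟦ x ⟧ ⟦ y ⟧ (subst Defined (⟦⟧-++ x y) (closure-sound h))
  closure-sound (≈-trans h h') = Both-trans ≡-trans (closure-sound h) (closure-sound h')
  closure-sound (≈-cong {x} {y} {k} h h') =
    subst (λ m → Both _≡_ m ⟦ y ++ k ⟧) (sym ⟦xk⟧≡⟦yk⟧) (closure-sound h')
    where
      ⟦xk⟧≡⟦yk⟧ : ⟦ x ++ k ⟧ ≡ ⟦ y ++ k ⟧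
      ⟦xk⟧≡⟦yk⟧ = begin
        ⟦ x ++ k ⟧       ≡⟨ ⟦⟧-++ x k ⟩
        ⟦ x ⟧ ⊛ ⟦ k ⟧    ≡⟨ cong (_⊛ ⟦ k ⟧) (Both-≡ (closure-sound h)) ⟩
        ⟦ y ⟧ ⊛ ⟦ k ⟧    ≡⟨ sym (⟦⟧-++ y k) ⟩
        ⟦ y ++ k ⟧       ∎
        where open ≡-Reasoning
  closure-sound (≍⇒≈ h) = Both-reflˡ (closure-sound h)
  closure-sound (≍-refl v h) = Both-refl (IsEquivalence.refl (∼-equiv v)) (closure-sound h)
  closure-sound (≍-sym {u = u} h) = Both-sym (IsEquivalence.sym (∼-equiv u)) (closure-sound h)
  closure-sound (≍-trans {u = u} h h') =
    Both-trans (IsEquivalence.trans (∼-equiv u)) (closure-sound h) (closure-sound h')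
  closure-sound (≍-subst {y = y} h h') =
    subst (λ m → Both _ m ⟦ y ⟧) (Both-≡ (closure-sound h')) (closure-sound h)

  ⌊⌋-≈ : ∀ {x y} → InD 𝒞 x → InD 𝒞 y → Closure 𝒞 (x ≈ y) → ⌊ x ⌋ ≡ ⌊ y ⌋
  ⌊⌋-≈ {x} {y} x∈𝒟 y∈𝒟 h =
    Both-just⁻¹ (closure-sound h) (⟦⟧-realized x x∈𝒟) (⟦⟧-realized y y∈𝒟)

  closed-unrealizable : Closed ℱ 𝒞 → ⊥
  closed-unrealizable (clash φ x y Tφx Fφy x≈y) with ⌊𝕋⌋ φ x Tφx | ⌊𝔽⌋ φ y Fφy
  ... | x∈𝒟 , x⊨φ | y∈𝒟 , y⊭φ = y⊭φ (subst (λ r → Sat M r φ) (⌊⌋-≈ x∈𝒟 y∈𝒟 x≈y) x⊨φ)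
  closed-unrealizable (F-I x FIx x≈ε) with ⌊𝔽⌋ If x FIx
  ... | x∈𝒟 , x⊭I = x⊭I (Both-just⁻¹ (closure-sound x≈ε) (⟦⟧-realized x x∈𝒟) ≡-refl)
  closed-unrealizable (F-⊤ x F⊤x) = proj₂ (⌊𝔽⌋ ⊤f x F⊤x) tt
  closed-unrealizable (T-⊥ x T⊥x) = proj₂ (⌊𝕋⌋ ⊥f x T⊥x)

lemma4 : (σ : Signature) (ℱ : Theory.LFormula σ → Set) (𝒞 : Theory.Constraint σ → Set) →
    Theory.IsCSS σ ℱ 𝒞 → Theory.Closed σ ℱ 𝒞 → ¬ Theory.Realization σ ℱ 𝒞
lemma4 σ ℱ 𝒞 _ closed ρ = Soundness.closed-unrealizable σ ℱ 𝒞 ρ closed
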